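{- For $n\geq3$ and $0\leq k\leq n-3$, $$S_{n,k}=S_{n,k-1}+2S_{n-1,k}-S_{n-1,k-1},$$ where $S_{m,j}$ denotes the number of $e\in\mathbf{I}_m(\geq,-,>)$ with $e_m=j$ (so $S_{m,-1}=0$).
   Context: $\mathbf{I}_n=\{(e_1,\ldots,e_n): 0\leq e_i<i\}$ is the set of inversion sequences of length $n$. $\mathbf{I}_n(\geq,-,>)$ is the set of $e\in\mathbf{I}_n$ with no indices $i<j<k$ such that $e_i\geq e_j$ and $e_i>e_k$. -}

module Defs where

open import Data.Nat using (ℕ; zero; suc; _<_; _≥_; _>_; _≤?_; _<?_)
open import Data.Integer using (ℤ; +_)
import Data.Integer as ℤ
open import Data.List using (List; []; _∷_; [_]; _++_; map; concatMap; upTo; length; filter; last)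
open import Data.List.Relation.Unary.All using (All)
open import Data.List.Relation.Unary.Any using (Any)
import Data.Maybe
import Data.Maybe.Properties
open import Data.Maybe using (Maybe; just; nothing)
open import Data.Product using (_×_; _,_; ∃-syntax)
open import Relation.Nullary using (¬_; Dec; yes; no)
open import Relation.Nullary.Decidable using (¬?)
open import Relation.Binary.PropositionalEquality using (_≡_)

-- An inversion sequence (e₁,…,eₙ) is represented as the list [e₁, …, eₙ].
-- Index i (1-based) of the list holds eᵢ, and 0 ≤ eᵢ < i.

I : ℕ → List (List ℕ)
I zero = [] ∷ []
I (suc n) = concatMap (λ e → map (λ x → e ++ [ x ]) (upTo (suc n))) (I n)

-- The pattern (≥,-,>) occurs in e: indices i<j<k with eᵢ ≥ eⱼ and eᵢ > eₖ.
data HasPatHead (a : ℕ) : List ℕ → Set where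
  here  : ∀ {b rest} → a ≥ b → Any (λ c → a > c) rest → HasPatHead a (b ∷ rest)
  there : ∀ {b rest} → HasPatHead a rest → HasPatHead a (b ∷ rest)

data HasPat : List ℕ → Set where
  here  : ∀ {a rest} → HasPatHead a rest → HasPat (a ∷ rest)
  there : ∀ {a rest} → HasPat rest → HasPat (a ∷ rest)

hasPatHead? : ∀ a l → Dec (HasPatHead a l)
hasPatHead? a [] = no λ ()
hasPatHead? a (b ∷ rest) with b ≤? a | Data.List.Relation.Unary.Any.any? (λ c → c <? a) rest | hasPatHead? a rest
... | yes p | yes q | _ = yes (here p q)
... | _ | _ | yes r = yes (there r)
... | no p | _ | no r = no λ { (here p' _) → p p' ; (there r') → r r' }
... | yes _ | no q | no r = no λ { (here _ q') → q q' ; (there r') → r r' }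

hasPat? : ∀ l → Dec (HasPat l)
hasPat? [] = no λ ()
hasPat? (a ∷ rest) with hasPatHead? a rest | hasPat? rest
... | yes p | _ = yes (here p)
... | _ | yes q = yes (there q)
... | no p | no q = no λ { (here p') → p p' ; (there q') → q q' }

Iavoid : ℕ → List (List ℕ)
Iavoid n = filter (λ e → ¬? (hasPat? e)) (I n)

-- S m j = #{ e ∈ I_m(≥,-,>) : e_m = j }, with j ∈ ℤ (so S m -1 = 0).
lastℤ : List ℕ → Maybe ℤ
lastℤ e = Data.Maybe.map +_ (last e)

S : ℕ → ℤ → ℕ
S m j = length (filter (λ e → Data.Maybe.Properties.≡-dec ℤ._≟_ (lastℤ e) (just j)) (Iavoid m))

module Submission where

-- Label an avoider e of length p by (c , d) = (p ∸ t e , p ∸ max e), where t e is the largest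
-- entry eᵢ followed by some eⱼ ≤ eᵢ.  Appending x to an avoider e creates the pattern exactly
-- when x < t e, so the avoiders of length p + 1 extending e are e ++ [ x ] for t e ≤ x ≤ p, and
-- their labels are c ∸ d + 1 copies of (d + 1 , d + 1) together with (c + 1 , d′) for d′ = d, …, 1.
-- Hence S (p + 1) k counts the avoiders of length p whose label has c ≥ p ∸ k, and the recurrence
-- reduces to count≡ (q + 1) (j + 1) = count≡ q j + count≥ q j for j ≥ 1, where count≡ and count≥
-- count the labels of a level with c = j and c ≥ j.  Summing the generating rule over a level,
-- this follows from the identities  Σ_{d = j} (c ∸ j) = #{d > j}  and
-- Σ_{c = j} Σ_{1 ≤ x < d} g x = Σ_{d < j ≤ c} g d,  the latter by induction on the level.

module Sums where

  open import Data.Nat using (ℕ; zero; suc; pred; _+_; _*_; _∸_; _⊓_; _≤_; _<_; z≤n; s≤s; _≤?_; _≟_)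
  open import Data.Nat.Properties
  open import Data.List using (List; []; _∷_; _++_; length; map; concatMap; replicate; applyDownFrom)
  open import Data.List.Properties using (length-++)
  open import Data.List.Relation.Unary.All using (All; []; _∷_)
  open import Function using (_∘_)
  open import Relation.Binary.PropositionalEquality
  open import Relation.Nullary using (yes; no; contradiction)
  open import Algebra.Properties.CommutativeSemigroup +-commutativeSemigroup using (interchange)

  private
    variable
      A B : Set

  ∑ : (A → ℕ) → List A → ℕ
  ∑ f [] = 0
  ∑ f (x ∷ xs) = f x + ∑ f xs

  ∑-++ : (f : A → ℕ) (xs ys : List A) → ∑ f (xs ++ ys) ≡ ∑ f xs + ∑ f ys
  ∑-++ f [] ys = refl
  ∑-++ f (x ∷ xs) ys = trans (cong (f x +_) (∑-++ f xs ys)) (sym (+-assoc (f x) _ _))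

  ∑-concatMap : (f : B → ℕ) (g : A → List B) (xs : List A) →
                ∑ f (concatMap g xs) ≡ ∑ (λ x → ∑ f (g x)) xs
  ∑-concatMap f g [] = refl
  ∑-concatMap f g (x ∷ xs) = trans (∑-++ f (g x) _) (cong (∑ f (g x) +_) (∑-concatMap f g xs))

  ∑-map : (f : B → ℕ) (g : A → B) (xs : List A) → ∑ f (map g xs) ≡ ∑ (f ∘ g) xs
  ∑-map f g [] = refl
  ∑-map f g (x ∷ xs) = cong (f (g x) +_) (∑-map f g xs)

  ∑-replicate : (f : A → ℕ) (n : ℕ) (x : A) → ∑ f (replicate n x) ≡ n * f x
  ∑-replicate f zero x = refl
  ∑-replicate f (suc n) x = cong (f x +_) (∑-replicate f n x)

  ∑-cong : {f g : A → ℕ} → (∀ x → f x ≡ g x) → (xs : List A) → ∑ f xs ≡ ∑ g xs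
  ∑-cong f≗g [] = refl
  ∑-cong f≗g (x ∷ xs) = cong₂ _+_ (f≗g x) (∑-cong f≗g xs)

  ∑-cong-local : {f g : A → ℕ} {xs : List A} → All (λ x → f x ≡ g x) xs → ∑ f xs ≡ ∑ g xs
  ∑-cong-local [] = refl
  ∑-cong-local (fx≡gx ∷ fxs≡gxs) = cong₂ _+_ fx≡gx (∑-cong-local fxs≡gxs)

  ∑-+ : (f g : A → ℕ) (xs : List A) → ∑ (λ x → f x + g x) xs ≡ ∑ f xs + ∑ g xs
  ∑-+ f g [] = refl
  ∑-+ f g (x ∷ xs) = trans (cong (f x + g x +_) (∑-+ f g xs)) (interchange (f x) (g x) _ _)

  ∑-*ˡ : (k : ℕ) (f : A → ℕ) (xs : List A) → ∑ (λ x → k * f x) xs ≡ k * ∑ f xs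
  ∑-*ˡ k f [] = sym (*-zeroʳ k)
  ∑-*ˡ k f (x ∷ xs) = trans (cong (k * f x +_) (∑-*ˡ k f xs)) (sym (*-distribˡ-+ k (f x) _))

  ∑-*ʳ : (k : ℕ) (f : A → ℕ) (xs : List A) → ∑ (λ x → f x * k) xs ≡ ∑ f xs * k
  ∑-*ʳ k f xs = trans (∑-cong (λ x → *-comm (f x) k) xs) (trans (∑-*ˡ k f xs) (*-comm k _))

  ∑-zero : (xs : List A) → ∑ (λ _ → 0) xs ≡ 0
  ∑-zero [] = refl
  ∑-zero (x ∷ xs) = ∑-zero xs

  length-concatMap : (f : A → List B) (xs : List A) → length (concatMap f xs) ≡ ∑ (length ∘ f) xs
  length-concatMap f [] = refl
  length-concatMap f (x ∷ xs) = trans (length-++ (f x)) (cong (length (f x) +_) (length-concatMap f xs))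

  ∑₁ : (ℕ → ℕ) → ℕ → ℕ
  ∑₁ f d = ∑ f (applyDownFrom suc d)

  ∑₁-const : (k d : ℕ) → ∑₁ (λ _ → k) d ≡ d * k
  ∑₁-const k zero = refl
  ∑₁-const k (suc d) = cong (k +_) (∑₁-const k d)

  ∑₁-∘pred : (f : ℕ → ℕ) → f 0 ≡ 0 → (d : ℕ) → ∑₁ (f ∘ pred) d ≡ ∑₁ f (pred d)
  ∑₁-∘pred f f0≡0 zero = refl
  ∑₁-∘pred f f0≡0 (suc zero) = trans (+-identityʳ (f 0)) f0≡0
  ∑₁-∘pred f f0≡0 (suc (suc d)) = cong (f (suc d) +_) (∑₁-∘pred f f0≡0 (suc d))

  ∸-split : ∀ {i d c} → i ≤ d → d ≤ c → c ∸ i ≡ (c ∸ d) + (d ∸ i)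
  ∸-split {i} {d} {c} i≤d d≤c = trans (cong (_∸ i) (sym (m∸n+n≡m d≤c))) (+-∸-assoc (c ∸ d) i≤d)

  ⟦_≡_⟧ : ℕ → ℕ → ℕ
  ⟦ zero ≡ zero ⟧ = 1
  ⟦ zero ≡ suc _ ⟧ = 0
  ⟦ suc _ ≡ zero ⟧ = 0
  ⟦ suc a ≡ suc b ⟧ = ⟦ a ≡ b ⟧

  ⟦_≤_⟧ : ℕ → ℕ → ℕ
  ⟦ zero ≤ _ ⟧ = 1
  ⟦ suc _ ≤ zero ⟧ = 0
  ⟦ suc a ≤ suc b ⟧ = ⟦ a ≤ b ⟧

  ⟦_<_⟧ : ℕ → ℕ → ℕ
  ⟦ a < b ⟧ = ⟦ suc a ≤ b ⟧

  ⟦≡⟧-refl : (a : ℕ) → ⟦ a ≡ a ⟧ ≡ 1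
  ⟦≡⟧-refl zero = refl
  ⟦≡⟧-refl (suc a) = ⟦≡⟧-refl a

  ⟦≡⟧-≢ : {a b : ℕ} → a ≢ b → ⟦ a ≡ b ⟧ ≡ 0
  ⟦≡⟧-≢ {zero} {zero} a≢b = contradiction refl a≢b
  ⟦≡⟧-≢ {zero} {suc b} a≢b = refl
  ⟦≡⟧-≢ {suc a} {zero} a≢b = refl
  ⟦≡⟧-≢ {suc a} {suc b} a≢b = ⟦≡⟧-≢ (a≢b ∘ cong suc)

  ⟦≤⟧-≤ : {a b : ℕ} → a ≤ b → ⟦ a ≤ b ⟧ ≡ 1
  ⟦≤⟧-≤ z≤n = refl
  ⟦≤⟧-≤ (s≤s a≤b) = ⟦≤⟧-≤ a≤b

  ⟦≤⟧-> : {a b : ℕ} → b < a → ⟦ a ≤ b ⟧ ≡ 0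
  ⟦≤⟧-> {suc a} {zero} b<a = refl
  ⟦≤⟧-> {suc a} {suc b} (s≤s b<a) = ⟦≤⟧-> b<a

  ⟦≡⟧-subst : (a b : ℕ) (h : ℕ → ℕ) → ⟦ a ≡ b ⟧ * h a ≡ ⟦ a ≡ b ⟧ * h b
  ⟦≡⟧-subst a b h with a ≟ b
  ... | yes refl = refl
  ... | no a≢b rewrite ⟦≡⟧-≢ a≢b = refl

  ⟦≡⟧*∸ : (a b : ℕ) → ⟦ a ≡ b ⟧ * (a ∸ b) ≡ 0
  ⟦≡⟧*∸ a b = trans (⟦≡⟧-subst a b (_∸ b)) (trans (cong (⟦ a ≡ b ⟧ *_) (n∸n≡0 b)) (*-zeroʳ ⟦ a ≡ b ⟧))

  ⟦≡⟧+⟦<⟧ : (a b : ℕ) → ⟦ a ≡ b ⟧ + ⟦ b < a ⟧ ≡ ⟦ b ≤ a ⟧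
  ⟦≡⟧+⟦<⟧ zero zero = refl
  ⟦≡⟧+⟦<⟧ zero (suc b) = refl
  ⟦≡⟧+⟦<⟧ (suc a) zero = refl
  ⟦≡⟧+⟦<⟧ (suc a) (suc b) = ⟦≡⟧+⟦<⟧ a b

  ⟦≤⟧*⟦<⟧ : (a b : ℕ) → ⟦ a ≤ b ⟧ * ⟦ b < a ⟧ ≡ 0
  ⟦≤⟧*⟦<⟧ zero b = refl
  ⟦≤⟧*⟦<⟧ (suc a) zero = refl
  ⟦≤⟧*⟦<⟧ (suc a) (suc b) = ⟦≤⟧*⟦<⟧ a b

  ⟦≤⟧-flip : ∀ {j k p t} → j + k ≡ p → t ≤ p → ⟦ t ≤ k ⟧ ≡ ⟦ j ≤ p ∸ t ⟧
  ⟦≤⟧-flip {j} {k} {p} {t} j+k≡p t≤p with t ≤? k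
  ... | yes t≤k = trans (⟦≤⟧-≤ t≤k) (sym (⟦≤⟧-≤ (m+n≤o⇒m≤o∸n j (subst (j + t ≤_) j+k≡p (+-monoʳ-≤ j t≤k)))))
  ... | no t≰k = trans (⟦≤⟧-> (≰⇒> t≰k)) (sym (⟦≤⟧-> (≰⇒> λ j≤p∸t →
    t≰k (+-cancelˡ-≤ j t k (subst (j + t ≤_) (sym j+k≡p) (m≤o∸n⇒m+n≤o j t≤p j≤p∸t))))))

  ∑₁-⟦≡⟧ : (i k d : ℕ) → ∑₁ (λ x → ⟦ x ≡ suc i ⟧ * k) d ≡ ⟦ suc i ≤ d ⟧ * k
  ∑₁-⟦≡⟧ i k zero = refl
  ∑₁-⟦≡⟧ i k (suc d) = begin
    ⟦ d ≡ i ⟧ * k + ∑₁ (λ x → ⟦ x ≡ suc i ⟧ * k) d ≡⟨ cong (⟦ d ≡ i ⟧ * k +_) (∑₁-⟦≡⟧ i k d) ⟩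
    ⟦ d ≡ i ⟧ * k + ⟦ i < d ⟧ * k                   ≡⟨ *-distribʳ-+ k ⟦ d ≡ i ⟧ _ ⟨
    (⟦ d ≡ i ⟧ + ⟦ i < d ⟧) * k                     ≡⟨ cong (_* k) (⟦≡⟧+⟦<⟧ d i) ⟩
    ⟦ i ≤ d ⟧ * k                                   ∎
    where open ≡-Reasoning

  ∑₁-⟦<⟧ : (i d : ℕ) → ∑₁ (λ x → ⟦ i < x ⟧) d ≡ d ∸ i
  ∑₁-⟦<⟧ i zero = sym (0∸n≡0 i)
  ∑₁-⟦<⟧ i (suc d) with i ≤? d
  ... | yes i≤d = trans (cong₂ _+_ (⟦≤⟧-≤ i≤d) (∑₁-⟦<⟧ i d)) (sym (+-∸-assoc 1 i≤d))
  ... | no i≰d = trans (cong₂ _+_ (⟦≤⟧-> d<i) (∑₁-⟦<⟧ i d))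
                       (trans (m≤n⇒m∸n≡0 (<⇒≤ d<i)) (sym (m≤n⇒m∸n≡0 d<i)))
    where d<i = ≰⇒> i≰d

  ∑₁-⟦≤⟧ : (f : ℕ → ℕ) (i d : ℕ) → ∑₁ (λ x → ⟦ x ≤ i ⟧ * f x) d ≡ ∑₁ f (d ⊓ i)
  ∑₁-⟦≤⟧ f i zero = refl
  ∑₁-⟦≤⟧ f i (suc d) with suc d ≤? i
  ... | yes d<i = begin
    ⟦ suc d ≤ i ⟧ * f (suc d) + ∑₁ (λ x → ⟦ x ≤ i ⟧ * f x) d
      ≡⟨ cong₂ _+_ (cong (_* f (suc d)) (⟦≤⟧-≤ d<i)) (∑₁-⟦≤⟧ f i d) ⟩
    1 * f (suc d) + ∑₁ f (d ⊓ i)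
      ≡⟨ cong₂ _+_ (*-identityˡ (f (suc d))) (cong (∑₁ f) (m≤n⇒m⊓n≡m (<⇒≤ d<i))) ⟩
    ∑₁ f (suc d)
      ≡⟨ cong (∑₁ f) (m≤n⇒m⊓n≡m d<i) ⟨
    ∑₁ f (suc d ⊓ i) ∎
    where open ≡-Reasoning
  ... | no d≮i = begin
    ⟦ suc d ≤ i ⟧ * f (suc d) + ∑₁ (λ x → ⟦ x ≤ i ⟧ * f x) d
      ≡⟨ cong₂ _+_ (cong (_* f (suc d)) (⟦≤⟧-> (≰⇒> d≮i))) (∑₁-⟦≤⟧ f i d) ⟩
    ∑₁ f (d ⊓ i)  ≡⟨ cong (∑₁ f) (m≥n⇒m⊓n≡n i≤d) ⟩
    ∑₁ f i        ≡⟨ cong (∑₁ f) (m≥n⇒m⊓n≡n (m≤n⇒m≤1+n i≤d)) ⟨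
    ∑₁ f (suc d ⊓ i) ∎
    where
    open ≡-Reasoning
    i≤d = ≤-pred (≰⇒> d≮i)

module GeneratingTree where

  open import Data.Nat using (ℕ; zero; suc; pred; _+_; _*_; _∸_; _⊓_; _≤_; _<_; z≤n; s≤s; _≤?_)
  open import Data.Nat.Properties
  open import Data.Product using (_×_; _,_)
  open import Data.List using (List; _∷_; [_]; _++_; map; concatMap; replicate; applyDownFrom)
  open import Data.List.Relation.Unary.All as All using (All; []; _∷_)
  open import Data.List.Relation.Unary.All.Properties using (++⁺; replicate⁺; map⁺; applyDownFrom⁺₁; concat⁺)
  open import Relation.Binary.PropositionalEquality hiding ([_])
  open import Relation.Nullary using (yes; no)
  open import Algebra.Properties.CommutativeSemigroup +-commutativeSemigroup using () renaming (x∙yz≈y∙xz to x+yz≡y+xz)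
  open import Algebra.Properties.CommutativeSemigroup *-commutativeSemigroup using () renaming (x∙yz≈y∙xz to x*yz≡y*xz)
  open import Data.Nat.Tactic.RingSolver using (solve-∀)
  open Sums

  Label : Set
  Label = ℕ × ℕ

  children : Label → List Label
  children (c , d) = replicate (suc (c ∸ d)) (suc d , suc d) ++ map (suc c ,_) (applyDownFrom suc d)

  -- level q holds the labels of the avoiders of length q + 1 (see labels-level).
  level : ℕ → List Label
  level zero = [ 1 , 1 ]
  level (suc q) = concatMap children (level q)

  Admissible : ℕ → Label → Set
  Admissible q (c , d) = 1 ≤ d × d ≤ c × c ≤ suc q

  children-admissible : ∀ {q c d} → Admissible q (c , d) → All (Admissible (suc q)) (children (c , d))
  children-admissible (1≤d , d≤c , c≤q) =
    ++⁺ (replicate⁺ _ (s≤s z≤n , ≤-refl , s≤s (≤-trans d≤c c≤q)))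
        (map⁺ (applyDownFrom⁺₁ suc _ λ x<d → s≤s z≤n , m≤n⇒m≤1+n (≤-trans x<d d≤c) , s≤s c≤q))

  level-admissible : ∀ q → All (Admissible q) (level q)
  level-admissible zero = (≤-refl , ≤-refl , s≤s z≤n) ∷ []
  level-admissible (suc q) = concat⁺ (map⁺ (All.map children-admissible (level-admissible q)))

  ∑-level-cong : ∀ q {f g : Label → ℕ} → (∀ {c d} → Admissible q (c , d) → f (c , d) ≡ g (c , d)) →
                 ∑ f (level q) ≡ ∑ g (level q)
  ∑-level-cong q f≡g = ∑-cong-local (All.map f≡g (level-admissible q))

  ∑-level-suc : ∀ q {f g : Label → ℕ} → (∀ {c d} → Admissible q (c , d) → ∑ f (children (c , d)) ≡ g (c , d)) →
                ∑ f (level (suc q)) ≡ ∑ g (level q)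
  ∑-level-suc q {f} step = trans (∑-concatMap f children (level q)) (∑-level-cong q step)

  ∑-children : (f : Label → ℕ) (c d : ℕ) →
               ∑ f (children (c , d)) ≡ suc (c ∸ d) * f (suc d , suc d) + ∑₁ (λ x → f (suc c , x)) d
  ∑-children f c d =
    trans (∑-++ f (replicate (suc (c ∸ d)) (suc d , suc d)) _)
          (cong₂ _+_ (∑-replicate f (suc (c ∸ d)) (suc d , suc d)) (∑-map f (suc c ,_) (applyDownFrom suc d)))

  excess-children : ∀ i {c d} → d ≤ c →
    ∑ (λ (c′ , d′) → ⟦ d′ ≡ suc i ⟧ * (c′ ∸ suc i)) (children (c , d)) ≡
    ∑ (λ (_ , d′) → ⟦ suc i < d′ ⟧) (children (c , d))
  excess-children i {c} {d} d≤c = begin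
    ∑ (λ (c′ , d′) → ⟦ d′ ≡ suc i ⟧ * (c′ ∸ suc i)) (children (c , d))
      ≡⟨ ∑-children _ c d ⟩
    suc (c ∸ d) * (⟦ d ≡ i ⟧ * (d ∸ i)) + ∑₁ (λ x → ⟦ x ≡ suc i ⟧ * (c ∸ i)) d
      ≡⟨ cong₂ _+_ (trans (cong (suc (c ∸ d) *_) (⟦≡⟧*∸ d i)) (*-zeroʳ (suc (c ∸ d)))) (∑₁-⟦≡⟧ i (c ∸ i) d) ⟩
    ⟦ suc i ≤ d ⟧ * (c ∸ i)
      ≡⟨ gap ⟩
    suc (c ∸ d) * ⟦ suc i ≤ d ⟧ + (d ∸ suc i)
      ≡⟨ cong (suc (c ∸ d) * ⟦ suc i ≤ d ⟧ +_) (∑₁-⟦<⟧ (suc i) d) ⟨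
    suc (c ∸ d) * ⟦ suc i < suc d ⟧ + ∑₁ (λ x → ⟦ suc i < x ⟧) d
      ≡⟨ ∑-children _ c d ⟨
    ∑ (λ (_ , d′) → ⟦ suc i < d′ ⟧) (children (c , d)) ∎
    where
    open ≡-Reasoning
    gap : ⟦ suc i ≤ d ⟧ * (c ∸ i) ≡ suc (c ∸ d) * ⟦ suc i ≤ d ⟧ + (d ∸ suc i)
    gap with suc i ≤? d
    ... | yes i<d rewrite ⟦≤⟧-≤ i<d = begin
      1 * (c ∸ i)                  ≡⟨ *-identityˡ (c ∸ i) ⟩
      c ∸ i                        ≡⟨ ∸-split (<⇒≤ i<d) d≤c ⟩
      (c ∸ d) + (d ∸ i)            ≡⟨ cong ((c ∸ d) +_) (+-∸-assoc 1 i<d) ⟩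
      (c ∸ d) + suc (d ∸ suc i)    ≡⟨ +-suc (c ∸ d) _ ⟩
      suc (c ∸ d) + (d ∸ suc i)    ≡⟨ cong (_+ (d ∸ suc i)) (*-identityʳ (suc (c ∸ d))) ⟨
      suc (c ∸ d) * 1 + (d ∸ suc i) ∎
    ... | no i≮d rewrite ⟦≤⟧-> (≰⇒> i≮d) | *-zeroʳ (suc (c ∸ d)) = sym (m≤n⇒m∸n≡0 (<⇒≤ (≰⇒> i≮d)))

  excess-level : ∀ q i →
    ∑ (λ (c , d) → ⟦ d ≡ suc i ⟧ * (c ∸ suc i)) (level q) ≡ ∑ (λ (_ , d) → ⟦ suc i < d ⟧) (level q)
  excess-level zero zero = refl
  excess-level zero (suc i) = refl
  excess-level (suc q) i =
    trans (∑-level-suc q (λ (_ , d≤c , _) → excess-children i d≤c)) (sym (∑-concatMap _ children (level q)))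

  excess-count-level : ∀ q i →
    ∑ (λ (c , d) → ⟦ d ≡ suc i ⟧ * suc (c ∸ suc i)) (level q) ≡ ∑ (λ (_ , d) → ⟦ suc i ≤ d ⟧) (level q)
  excess-count-level q i = begin
    ∑ (λ (c , d) → ⟦ d ≡ suc i ⟧ * suc (c ∸ suc i)) (level q)
      ≡⟨ ∑-cong (λ (c , d) → *-suc ⟦ d ≡ suc i ⟧ (c ∸ suc i)) (level q) ⟩
    ∑ (λ (c , d) → ⟦ d ≡ suc i ⟧ + ⟦ d ≡ suc i ⟧ * (c ∸ suc i)) (level q)
      ≡⟨ ∑-+ _ _ (level q) ⟩
    ∑ (λ (_ , d) → ⟦ d ≡ suc i ⟧) (level q) + ∑ (λ (c , d) → ⟦ d ≡ suc i ⟧ * (c ∸ suc i)) (level q)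
      ≡⟨ cong (∑ (λ (_ , d) → ⟦ d ≡ suc i ⟧) (level q) +_) (excess-level q i) ⟩
    ∑ (λ (_ , d) → ⟦ d ≡ suc i ⟧) (level q) + ∑ (λ (_ , d) → ⟦ suc i < d ⟧) (level q)
      ≡⟨ ∑-+ _ _ (level q) ⟨
    ∑ (λ (_ , d) → ⟦ d ≡ suc i ⟧ + ⟦ suc i < d ⟧) (level q)
      ≡⟨ ∑-cong (λ (_ , d) → ⟦≡⟧+⟦<⟧ d (suc i)) (level q) ⟩
    ∑ (λ (_ , d) → ⟦ suc i ≤ d ⟧) (level q) ∎
    where open ≡-Reasoning

  weighted-children-lhs : ∀ (g : ℕ → ℕ) i c d →
    ∑ (λ (c′ , d′) → ⟦ c′ ≡ suc i ⟧ * ∑₁ g (pred d′)) (children (c , d)) ≡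
    ⟦ d ≡ i ⟧ * suc (c ∸ i) * ∑₁ g i + ⟦ c ≡ i ⟧ * ∑₁ (∑₁ g) (pred d)
  weighted-children-lhs g i c d = begin
    ∑ (λ (c′ , d′) → ⟦ c′ ≡ suc i ⟧ * ∑₁ g (pred d′)) (children (c , d))
      ≡⟨ ∑-children _ c d ⟩
    suc (c ∸ d) * (⟦ d ≡ i ⟧ * ∑₁ g d) + ∑₁ (λ x → ⟦ c ≡ i ⟧ * ∑₁ g (pred x)) d
      ≡⟨ cong₂ _+_ (x*yz≡y*xz (suc (c ∸ d)) ⟦ d ≡ i ⟧ (∑₁ g d)) (∑-*ˡ ⟦ c ≡ i ⟧ _ (applyDownFrom suc d)) ⟩
    ⟦ d ≡ i ⟧ * (suc (c ∸ d) * ∑₁ g d) + ⟦ c ≡ i ⟧ * ∑₁ (λ x → ∑₁ g (pred x)) d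
      ≡⟨ cong₂ _+_ (⟦≡⟧-subst d i (λ x → suc (c ∸ x) * ∑₁ g x)) (cong (⟦ c ≡ i ⟧ *_) (∑₁-∘pred (∑₁ g) refl d)) ⟩
    ⟦ d ≡ i ⟧ * (suc (c ∸ i) * ∑₁ g i) + ⟦ c ≡ i ⟧ * ∑₁ (∑₁ g) (pred d)
      ≡⟨ cong (_+ ⟦ c ≡ i ⟧ * ∑₁ (∑₁ g) (pred d)) (*-assoc ⟦ d ≡ i ⟧ _ _) ⟨
    ⟦ d ≡ i ⟧ * suc (c ∸ i) * ∑₁ g i + ⟦ c ≡ i ⟧ * ∑₁ (∑₁ g) (pred d) ∎
    where open ≡-Reasoning

  weighted-children-rhs : ∀ (g : ℕ → ℕ) i {c d} → d ≤ c →
    ∑ (λ (c′ , d′) → ⟦ suc i ≤ c′ ⟧ * ⟦ d′ < suc i ⟧ * g d′) (children (c , d)) ≡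
    ⟦ i ≤ d ⟧ * ∑₁ g i + ⟦ i ≤ c ⟧ * ⟦ d < i ⟧ * ∑₁ g d
  weighted-children-rhs g i {c} {d} d≤c = begin
    ∑ (λ (c′ , d′) → ⟦ suc i ≤ c′ ⟧ * ⟦ d′ < suc i ⟧ * g d′) (children (c , d))
      ≡⟨ ∑-children _ c d ⟩
    suc (c ∸ d) * (⟦ i ≤ d ⟧ * ⟦ d < i ⟧ * g (suc d)) + ∑₁ (λ x → ⟦ i ≤ c ⟧ * ⟦ x ≤ i ⟧ * g x) d
      ≡⟨ cong₂ _+_ (trans (cong (λ z → suc (c ∸ d) * (z * g (suc d))) (⟦≤⟧*⟦<⟧ i d)) (*-zeroʳ (suc (c ∸ d))))
                   (trans (∑-cong (λ x → *-assoc ⟦ i ≤ c ⟧ ⟦ x ≤ i ⟧ (g x)) (applyDownFrom suc d))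
                          (∑-*ˡ ⟦ i ≤ c ⟧ _ (applyDownFrom suc d))) ⟩
    ⟦ i ≤ c ⟧ * ∑₁ (λ x → ⟦ x ≤ i ⟧ * g x) d
      ≡⟨ cong (⟦ i ≤ c ⟧ *_) (∑₁-⟦≤⟧ g i d) ⟩
    ⟦ i ≤ c ⟧ * ∑₁ g (d ⊓ i)
      ≡⟨ split ⟩
    ⟦ i ≤ d ⟧ * ∑₁ g i + ⟦ i ≤ c ⟧ * ⟦ d < i ⟧ * ∑₁ g d ∎
    where
    open ≡-Reasoning
    split : ⟦ i ≤ c ⟧ * ∑₁ g (d ⊓ i) ≡ ⟦ i ≤ d ⟧ * ∑₁ g i + ⟦ i ≤ c ⟧ * ⟦ d < i ⟧ * ∑₁ g d
    split with i ≤? d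
    ... | yes i≤d rewrite ⟦≤⟧-≤ (≤-trans i≤d d≤c) | m≥n⇒m⊓n≡n i≤d | ⟦≤⟧-≤ i≤d | ⟦≤⟧-> (s≤s i≤d) =
      sym (+-identityʳ _)
    ... | no i≰d rewrite m≤n⇒m⊓n≡m (<⇒≤ (≰⇒> i≰d)) | ⟦≤⟧-> (≰⇒> i≰d) | ⟦≤⟧-≤ (≰⇒> i≰d) =
      cong (_* ∑₁ g d) (sym (*-identityʳ ⟦ i ≤ c ⟧))

  -- Stated for every g because the step for g uses the identity for ∑₁ g.
  weighted-level : ∀ q (g : ℕ → ℕ) j →
    ∑ (λ (c , d) → ⟦ c ≡ j ⟧ * ∑₁ g (pred d)) (level q) ≡ ∑ (λ (c , d) → ⟦ j ≤ c ⟧ * ⟦ d < j ⟧ * g d) (level q)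
  weighted-level q g zero =
    ∑-level-cong q (λ (1≤d , d≤c , _) → cong (_* _) (⟦≡⟧-≢ (>⇒≢ (≤-trans 1≤d d≤c))))
  weighted-level zero g (suc zero) = refl
  weighted-level zero g (suc (suc i)) = refl
  weighted-level (suc q) g (suc i) = begin
    ∑ (λ (c , d) → ⟦ c ≡ suc i ⟧ * ∑₁ g (pred d)) (level (suc q))
      ≡⟨ ∑-level-suc q (λ {c} {d} _ → weighted-children-lhs g i c d) ⟩
    ∑ (λ (c , d) → ⟦ d ≡ i ⟧ * suc (c ∸ i) * ∑₁ g i + ⟦ c ≡ i ⟧ * ∑₁ (∑₁ g) (pred d)) (level q)
      ≡⟨ ∑-+ _ _ (level q) ⟩
    ∑ (λ (c , d) → ⟦ d ≡ i ⟧ * suc (c ∸ i) * ∑₁ g i) (level q) +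
    ∑ (λ (c , d) → ⟦ c ≡ i ⟧ * ∑₁ (∑₁ g) (pred d)) (level q)
      ≡⟨ cong₂ _+_ (scaled i) (weighted-level q (∑₁ g) i) ⟩
    ∑ (λ (_ , d) → ⟦ i ≤ d ⟧ * ∑₁ g i) (level q) + ∑ (λ (c , d) → ⟦ i ≤ c ⟧ * ⟦ d < i ⟧ * ∑₁ g d) (level q)
      ≡⟨ ∑-+ _ _ (level q) ⟨
    ∑ (λ (c , d) → ⟦ i ≤ d ⟧ * ∑₁ g i + ⟦ i ≤ c ⟧ * ⟦ d < i ⟧ * ∑₁ g d) (level q)
      ≡⟨ ∑-level-suc q (λ (_ , d≤c , _) → weighted-children-rhs g i d≤c) ⟨
    ∑ (λ (c , d) → ⟦ suc i ≤ c ⟧ * ⟦ d < suc i ⟧ * g d) (level (suc q)) ∎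
    where
    open ≡-Reasoning
    scaled : ∀ m → ∑ (λ (c , d) → ⟦ d ≡ m ⟧ * suc (c ∸ m) * ∑₁ g m) (level q) ≡
                   ∑ (λ (_ , d) → ⟦ m ≤ d ⟧ * ∑₁ g m) (level q)
    scaled zero =
      trans (∑-cong (λ (c , d) → *-zeroʳ (⟦ d ≡ 0 ⟧ * suc c)) (level q))
            (sym (∑-cong (λ (_ , d) → *-zeroʳ ⟦ 0 ≤ d ⟧) (level q)))
    scaled (suc m) =
      trans (∑-*ʳ (∑₁ g (suc m)) _ (level q))
            (trans (cong (_* ∑₁ g (suc m)) (excess-count-level q m)) (sym (∑-*ʳ (∑₁ g (suc m)) _ (level q))))

  count≡ : ℕ → ℕ → ℕ
  count≡ q j = ∑ (λ (c , _) → ⟦ c ≡ j ⟧) (level q)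

  count≥ : ℕ → ℕ → ℕ
  count≥ q j = ∑ (λ (c , _) → ⟦ j ≤ c ⟧) (level q)

  count≥-split : ∀ q j → count≥ q j ≡ count≡ q j + count≥ q (suc j)
  count≥-split q j = trans (∑-cong (λ (c , _) → sym (⟦≡⟧+⟦<⟧ c j)) (level q)) (∑-+ _ _ (level q))

  count≥-beyond : ∀ q j → suc (suc q) ≤ j → count≥ q j ≡ 0
  count≥-beyond q j q<j =
    trans (∑-level-cong q (λ (_ , _ , c≤q) → ⟦≤⟧-> (≤-trans (s≤s c≤q) q<j))) (∑-zero (level q))

  count≡-suc : ∀ q i → count≡ (suc q) (suc (suc i)) ≡ count≡ q (suc i) + count≥ q (suc i)
  count≡-suc q i = begin
    count≡ (suc q) (suc j)
      ≡⟨ ∑-level-suc q (λ {c} {d} _ → node c d) ⟩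
    ∑ (λ (c , d) → ⟦ d ≡ j ⟧ * suc (c ∸ j) + ⟦ c ≡ j ⟧ * d) (level q)
      ≡⟨ ∑-+ _ _ (level q) ⟩
    ∑ (λ (c , d) → ⟦ d ≡ j ⟧ * suc (c ∸ j)) (level q) + ∑ (λ (c , d) → ⟦ c ≡ j ⟧ * d) (level q)
      ≡⟨ cong₂ _+_ (excess-count-level q i) weight ⟩
    deep + (count≡ q j + shallow)
      ≡⟨ x+yz≡y+xz deep (count≡ q j) shallow ⟩
    count≡ q j + (deep + shallow)
      ≡⟨ cong (count≡ q j +_) (trans (sym (∑-+ _ _ (level q))) (∑-level-cong q (λ (_ , d≤c , _) → cover d≤c))) ⟩
    count≡ q j + count≥ q j ∎
    where
    open ≡-Reasoning
    j = suc i
    deep shallow : ℕ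
    deep = ∑ (λ (_ , d) → ⟦ j ≤ d ⟧) (level q)
    shallow = ∑ (λ (c , d) → ⟦ j ≤ c ⟧ * ⟦ d < j ⟧ * 1) (level q)
    node : ∀ c d → ∑ (λ (c′ , _) → ⟦ c′ ≡ suc j ⟧) (children (c , d)) ≡ ⟦ d ≡ j ⟧ * suc (c ∸ j) + ⟦ c ≡ j ⟧ * d
    node c d = trans (∑-children _ c d)
      (cong₂ _+_ (trans (*-comm (suc (c ∸ d)) ⟦ d ≡ j ⟧) (⟦≡⟧-subst d j (λ x → suc (c ∸ x))))
                 (trans (∑₁-const ⟦ c ≡ j ⟧ d) (*-comm d ⟦ c ≡ j ⟧)))
    weight : ∑ (λ (c , d) → ⟦ c ≡ j ⟧ * d) (level q) ≡ count≡ q j + shallow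
    weight = begin
      ∑ (λ (c , d) → ⟦ c ≡ j ⟧ * d) (level q)
        ≡⟨ ∑-level-cong q (λ { {c} {suc d} _ → trans (*-suc ⟦ c ≡ j ⟧ d)
                                                      (cong (λ z → ⟦ c ≡ j ⟧ + ⟦ c ≡ j ⟧ * z)
                                                            (sym (trans (∑₁-const 1 d) (*-identityʳ d)))) }) ⟩
      ∑ (λ (c , d) → ⟦ c ≡ j ⟧ + ⟦ c ≡ j ⟧ * ∑₁ (λ _ → 1) (pred d)) (level q)
        ≡⟨ ∑-+ _ _ (level q) ⟩
      count≡ q j + ∑ (λ (c , d) → ⟦ c ≡ j ⟧ * ∑₁ (λ _ → 1) (pred d)) (level q)
        ≡⟨ cong (count≡ q j +_) (weighted-level q (λ _ → 1) j) ⟩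
      count≡ q j + shallow ∎
    cover : ∀ {c d} → d ≤ c → ⟦ j ≤ d ⟧ + ⟦ j ≤ c ⟧ * ⟦ d < j ⟧ * 1 ≡ ⟦ j ≤ c ⟧
    cover {c} {d} d≤c with j ≤? d
    ... | yes j≤d rewrite ⟦≤⟧-≤ j≤d | ⟦≤⟧-≤ (≤-trans j≤d d≤c) | ⟦≤⟧-> (s≤s j≤d) = refl
    ... | no j≰d rewrite ⟦≤⟧-> (≰⇒> j≰d) | ⟦≤⟧-≤ (≰⇒> j≰d) = trans (*-identityʳ _) (*-identityʳ _)

  count≥-recurrence : ∀ q i →
    count≥ (suc q) (2 + i) + count≥ q (2 + i) ≡ count≥ (suc q) (3 + i) + 2 * count≥ q (1 + i)
  count≥-recurrence q i = begin
    count≥ (suc q) (2 + i) + b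
      ≡⟨ cong (_+ b) (trans (count≥-split (suc q) (2 + i)) (cong (_+ a) (count≡-suc q i))) ⟩
    n + count≥ q (1 + i) + a + b
      ≡⟨ cong (λ h → n + h + a + b) (count≥-split q (1 + i)) ⟩
    n + (n + b) + a + b
      ≡⟨ rearrange n a b ⟩
    a + 2 * (n + b)
      ≡⟨ cong (λ h → a + 2 * h) (count≥-split q (1 + i)) ⟨
    a + 2 * count≥ q (1 + i) ∎
    where
    open ≡-Reasoning
    n = count≡ q (1 + i)
    a = count≥ (suc q) (3 + i)
    b = count≥ q (2 + i)
    rearrange : ∀ n a b → n + (n + b) + a + b ≡ a + 2 * (n + b)
    rearrange = solve-∀

module Avoidance where

  open import Level using (0ℓ)
  open import Data.Bool using (true; false; if_then_else_)
  open import Data.Nat using (ℕ; _⊔_; _≤_; _<_; z≤n; _≤?_)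
  open import Data.Nat.Properties
  open import Data.List using (List; []; _∷_; _++_; [_])
  open import Data.List.Relation.Unary.Any using (Any; here; there; any?)
  open import Data.List.Relation.Unary.Any.Properties using (++⁺ˡ; ++⁺ʳ; ++⁻)
  open import Data.Product using (_×_; _,_)
  open import Data.Sum using (_⊎_; inj₁; inj₂; [_,_]′)
  open import Function using (_∘_)
  open import Relation.Binary.PropositionalEquality hiding ([_])
  open import Relation.Nullary using (¬_; does; yes; no; contradiction)
  open import Relation.Nullary.Decidable using (dec-true; dec-false)
  open import Relation.Unary using (Pred; Decidable)
  open import Defs using (HasPatHead; HasPat; here; there)

  private
    variable
      A : Set

  any?-snoc-false : {P : Pred A 0ℓ} (P? : Decidable P) (xs : List A) {x : A} →
                    ¬ P x → does (any? P? (xs ++ [ x ])) ≡ does (any? P? xs)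
  any?-snoc-false P? xs ¬px with any? P? xs
  ... | yes p = dec-true (any? P? _) (++⁺ˡ p)
  ... | no ¬p = dec-false (any? P? _) λ q → [ ¬p , (λ { (here px) → ¬px px }) ]′ (++⁻ xs q)

  maximum : List ℕ → ℕ
  maximum [] = 0
  maximum (a ∷ r) = a ⊔ maximum r

  barrier : ℕ → List ℕ → ℕ
  barrier a r = if does (any? (_≤? a) r) then a else 0

  threshold : List ℕ → ℕ
  threshold [] = 0
  threshold (a ∷ r) = barrier a r ⊔ threshold r

  barrier≤ : ∀ a r → barrier a r ≤ a
  barrier≤ a r with does (any? (_≤? a) r)
  ... | true = ≤-refl
  ... | false = z≤n

  barrier-any : ∀ {a r} → Any (_≤ a) r → barrier a r ≡ a
  barrier-any {a} {r} p = cong (λ b → if b then a else 0) (dec-true (any? (_≤? a) r) p)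

  barrier-snoc-≤ : ∀ {a} r {x} → x ≤ a → barrier a (r ++ [ x ]) ≡ a
  barrier-snoc-≤ r x≤a = barrier-any (++⁺ʳ r (here x≤a))

  barrier-snoc-> : ∀ {a} r {x} → a < x → barrier a (r ++ [ x ]) ≡ barrier a r
  barrier-snoc-> {a} r a<x = cong (λ b → if b then a else 0) (any?-snoc-false (_≤? a) r (<⇒≱ a<x))

  threshold≤maximum : ∀ e → threshold e ≤ maximum e
  threshold≤maximum [] = z≤n
  threshold≤maximum (a ∷ r) = ⊔-mono-≤ (barrier≤ a r) (threshold≤maximum r)

  maximum-snoc : ∀ e x → maximum (e ++ [ x ]) ≡ maximum e ⊔ x
  maximum-snoc [] x = ⊔-identityʳ x
  maximum-snoc (a ∷ r) x = trans (cong (a ⊔_) (maximum-snoc r x)) (sym (⊔-assoc a (maximum r) x))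

  threshold-snoc-above : ∀ e {x} → maximum e < x → threshold (e ++ [ x ]) ≡ threshold e
  threshold-snoc-above [] M<x = refl
  threshold-snoc-above (a ∷ r) M<x =
    cong₂ _⊔_ (barrier-snoc-> r (m⊔n<o⇒m<o a _ M<x)) (threshold-snoc-above r (m⊔n<o⇒n<o a _ M<x))

  threshold-snoc-below : ∀ e {x} → x ≤ maximum e → threshold (e ++ [ x ]) ≡ maximum e
  threshold-snoc-below [] z≤n = refl
  threshold-snoc-below (a ∷ r) {x} x≤M with x ≤? a | x ≤? maximum r
  ... | yes x≤a | yes x≤Mr = cong₂ _⊔_ (barrier-snoc-≤ r x≤a) (threshold-snoc-below r x≤Mr)
  ... | yes x≤a | no x≰Mr = begin
    barrier a (r ++ [ x ]) ⊔ threshold (r ++ [ x ])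
      ≡⟨ cong₂ _⊔_ (barrier-snoc-≤ r x≤a) (threshold-snoc-above r (≰⇒> x≰Mr)) ⟩
    a ⊔ threshold r  ≡⟨ m≥n⇒m⊔n≡m (≤-trans (threshold≤maximum r) Mr≤a) ⟩
    a                ≡⟨ m≥n⇒m⊔n≡m Mr≤a ⟨
    a ⊔ maximum r    ∎
    where
    open ≡-Reasoning
    Mr≤a = ≤-trans (<⇒≤ (≰⇒> x≰Mr)) x≤a
  ... | no x≰a | yes x≤Mr = begin
    barrier a (r ++ [ x ]) ⊔ threshold (r ++ [ x ])
      ≡⟨ cong₂ _⊔_ (barrier-snoc-> r (≰⇒> x≰a)) (threshold-snoc-below r x≤Mr) ⟩
    barrier a r ⊔ maximum r  ≡⟨ m≤n⇒m⊔n≡n (≤-trans (barrier≤ a r) a≤Mr) ⟩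
    maximum r                ≡⟨ m≤n⇒m⊔n≡n a≤Mr ⟨
    a ⊔ maximum r            ∎
    where
    open ≡-Reasoning
    a≤Mr = ≤-trans (<⇒≤ (≰⇒> x≰a)) x≤Mr
  ... | no x≰a | no x≰Mr = contradiction x≤M (<⇒≱ (⊔-lub (≰⇒> x≰a) (≰⇒> x≰Mr)))

  HasPatHead-++ : ∀ {a} r ys → HasPatHead a r → HasPatHead a (r ++ ys)
  HasPatHead-++ (b ∷ r) ys (here b≤a p) = here b≤a (++⁺ˡ p)
  HasPatHead-++ (b ∷ r) ys (there h) = there (HasPatHead-++ r ys h)

  HasPat-++ : ∀ e ys → HasPat e → HasPat (e ++ ys)
  HasPat-++ (a ∷ r) ys (here h) = here (HasPatHead-++ r ys h)
  HasPat-++ (a ∷ r) ys (there h) = there (HasPat-++ r ys h)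

  HasPatHead-snoc : ∀ {a} r {x} → Any (_≤ a) r → x < a → HasPatHead a (r ++ [ x ])
  HasPatHead-snoc (b ∷ r) (here b≤a) x<a = here b≤a (++⁺ʳ r (here x<a))
  HasPatHead-snoc (b ∷ r) (there p) x<a = there (HasPatHead-snoc r p x<a)

  HasPatHead-snoc⁻ : ∀ {a} r {x} → HasPatHead a (r ++ [ x ]) → HasPatHead a r ⊎ (Any (_≤ a) r × x < a)
  HasPatHead-snoc⁻ [] (here _ ())
  HasPatHead-snoc⁻ [] (there ())
  HasPatHead-snoc⁻ (b ∷ r) (here b≤a p) with ++⁻ r p
  ... | inj₁ p′ = inj₁ (here b≤a p′)
  ... | inj₂ (here x<a) = inj₂ (here b≤a , x<a)
  HasPatHead-snoc⁻ (b ∷ r) (there h) with HasPatHead-snoc⁻ r h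
  ... | inj₁ h′ = inj₁ (there h′)
  ... | inj₂ (p , x<a) = inj₂ (there p , x<a)

  <⊔⇒ : ∀ {x m n} → x < m ⊔ n → x < m ⊎ x < n
  <⊔⇒ {x} {m} {n} x<m⊔n with ⊔-sel m n
  ... | inj₁ m⊔n≡m = inj₁ (subst (x <_) m⊔n≡m x<m⊔n)
  ... | inj₂ m⊔n≡n = inj₂ (subst (x <_) m⊔n≡n x<m⊔n)

  HasPat-snoc-below : ∀ e {x} → x < threshold e → HasPat (e ++ [ x ])
  HasPat-snoc-below (a ∷ r) {x} x<t with any? (_≤? a) r
  ... | yes p = [ here ∘ HasPatHead-snoc r p , there ∘ HasPat-snoc-below r ]′ (<⊔⇒ x<t)
  ... | no _ = there (HasPat-snoc-below r x<t)

  ¬HasPat-snoc : ∀ e {x} → ¬ HasPat e → threshold e ≤ x → ¬ HasPat (e ++ [ x ])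
  ¬HasPat-snoc [] _ _ (here ())
  ¬HasPat-snoc [] _ _ (there ())
  ¬HasPat-snoc (a ∷ r) avoids t≤x (here h) with HasPatHead-snoc⁻ r h
  ... | inj₁ h′ = avoids (here h′)
  ... | inj₂ (p , x<a) = <⇒≱ x<a (≤-trans (subst (_≤ threshold (a ∷ r)) (barrier-any p) (m≤m⊔n _ _)) t≤x)
  ¬HasPat-snoc (a ∷ r) avoids t≤x (there h) = ¬HasPat-snoc r (avoids ∘ there) (≤-trans (m≤n⊔m _ _) t≤x) h

module Enumeration where

  open import Data.Nat using (ℕ; zero; suc; _+_; _*_; _∸_; _≤_; _<_; z≤n; s≤s; _≟_)
  open import Data.Nat.Properties
  open import Data.Integer using (ℤ; +_; -[1+_])
  import Data.Integer as ℤ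
  import Data.Integer.Properties as ℤ
  open import Data.List using (List; []; _∷_; [_]; _++_; map; concat; concatMap; filter; length; last; replicate; upTo; applyUpTo; applyDownFrom)
  open import Data.List.Properties using (map-++; map-∘; filter-++; filter-all; filter-none; filter-accept; filter-reject; map-concatMap; concatMap-map; map-cong-local)
  open import Data.List.Relation.Unary.All as All using (All; []; _∷_)
  open import Data.List.Relation.Unary.All.Properties using (++⁺; map⁺; concat⁺; applyUpTo⁺₁; filter⁺)
  open import Data.Maybe using (just; nothing)
  import Data.Maybe as Maybe
  open import Data.Maybe.Properties using (just-injective; ≡-dec)
  open import Data.Product using (_,_)
  open import Function using (_∘_; id)
  open import Level using (0ℓ)
  open import Relation.Binary.PropositionalEquality hiding ([_])
  open import Relation.Nullary using (¬_; yes; no)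
  open import Relation.Nullary.Decidable using (¬?)
  open import Relation.Unary using (Pred; Decidable)
  open import Defs
  open Sums
  open GeneratingTree
  open Avoidance

  private
    variable
      A B : Set

  filter-concatMap : {P : Pred B 0ℓ} (P? : Decidable P) (f : A → List B) (xs : List A) →
                     filter P? (concatMap f xs) ≡ concatMap (filter P? ∘ f) xs
  filter-concatMap P? f [] = refl
  filter-concatMap P? f (x ∷ xs) = trans (filter-++ P? (f x) _) (cong (filter P? (f x) ++_) (filter-concatMap P? f xs))

  concatMap-filter : {P Q : Pred A 0ℓ} (P? : Decidable P) {f g : A → List B} {xs : List A} → All Q xs →
                     (∀ {x} → Q x → P x → f x ≡ g x) → (∀ {x} → ¬ P x → f x ≡ []) →
                     concatMap f xs ≡ concatMap g (filter P? xs)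
  concatMap-filter P? [] kept dropped = refl
  concatMap-filter P? {f} {xs = x ∷ xs} (qx ∷ qxs) kept dropped with P? x
  ... | yes px = cong₂ _++_ (kept qx px) (concatMap-filter P? qxs kept dropped)
  ... | no ¬px = trans (cong (_++ concatMap f xs) (dropped ¬px)) (concatMap-filter P? qxs kept dropped)

  interval : ℕ → ℕ → List ℕ
  interval a zero = []
  interval a (suc n) = a ∷ interval (suc a) n

  applyUpTo≡interval : ∀ (f : ℕ → ℕ) a n → (∀ x → f x ≡ a + x) → applyUpTo f n ≡ interval a n
  applyUpTo≡interval f a zero f≗a+ = refl
  applyUpTo≡interval f a (suc n) f≗a+ =
    cong₂ _∷_ (trans (f≗a+ 0) (+-identityʳ a))
              (applyUpTo≡interval (f ∘ suc) (suc a) n (λ x → trans (f≗a+ (suc x)) (+-suc a x)))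

  interval-++ : ∀ a m n → interval a (m + n) ≡ interval a m ++ interval (a + m) n
  interval-++ a zero n = cong (λ b → interval b n) (sym (+-identityʳ a))
  interval-++ a (suc m) n =
    cong (a ∷_) (trans (interval-++ (suc a) m n) (cong (λ b → interval (suc a) m ++ interval b n) (sym (+-suc a m))))

  interval⁺ : {P : Pred ℕ 0ℓ} → ∀ a n → (∀ {x} → a ≤ x → x < a + n → P x) → All P (interval a n)
  interval⁺ a zero Px = []
  interval⁺ a (suc n) Px =
    Px ≤-refl (m<m+n a (s≤s z≤n)) ∷ interval⁺ (suc a) n (λ {x} a<x x< → Px (<⇒≤ a<x) (subst (x <_) (sym (+-suc a n)) x<))

  map-interval-const : ∀ {F : ℕ → B} {v} a n {N} → a + n ≡ N → (∀ {x} → x < N → F x ≡ v) →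
                       map F (interval a n) ≡ replicate n v
  map-interval-const a zero eq Fx≡v = refl
  map-interval-const a (suc n) eq Fx≡v =
    cong₂ _∷_ (Fx≡v (subst (a <_) eq (m<m+n a (s≤s z≤n))))
              (map-interval-const (suc a) n (trans (sym (+-suc a n)) eq) Fx≡v)

  map-interval-downFrom : ∀ {F : ℕ → B} {g : ℕ → B} a n {N} → a + n ≡ N → (∀ {x} → a ≤ x → F x ≡ g (N ∸ x)) →
                          map F (interval a n) ≡ map g (applyDownFrom suc n)
  map-interval-downFrom a zero eq Fx≡g = refl
  map-interval-downFrom {g = g} a (suc n) eq Fx≡g =
    cong₂ _∷_ (trans (Fx≡g ≤-refl) (cong g (trans (cong (_∸ a) (sym eq)) (m+n∸m≡n a (suc n)))))
              (map-interval-downFrom (suc a) n (trans (sym (+-suc a n)) eq) (Fx≡g ∘ <⇒≤))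

  t+1+[M∸t]≡1+M : ∀ {t M} → t ≤ M → t + suc (M ∸ t) ≡ suc M
  t+1+[M∸t]≡1+M {t} {M} t≤M = trans (+-suc t (M ∸ t)) (cong suc (m+[n∸m]≡n t≤M))

  interval-split : ∀ {t M p} → t ≤ M → M ≤ p →
                   interval t (suc p ∸ t) ≡ interval t (suc (M ∸ t)) ++ interval (suc M) (p ∸ M)
  interval-split {t} {M} {p} t≤M M≤p = begin
    interval t (suc p ∸ t)
      ≡⟨ cong (interval t) (+-∸-assoc 1 (≤-trans t≤M M≤p)) ⟩
    interval t (suc (p ∸ t))
      ≡⟨ cong (interval t ∘ suc) (trans (∸-split t≤M M≤p) (+-comm (p ∸ M) (M ∸ t))) ⟩
    interval t (suc (M ∸ t) + (p ∸ M))
      ≡⟨ interval-++ t (suc (M ∸ t)) (p ∸ M) ⟩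
    interval t (suc (M ∸ t)) ++ interval (t + suc (M ∸ t)) (p ∸ M)
      ≡⟨ cong (λ b → interval t (suc (M ∸ t)) ++ interval b (p ∸ M)) (t+1+[M∸t]≡1+M t≤M) ⟩
    interval t (suc (M ∸ t)) ++ interval (suc M) (p ∸ M) ∎
    where open ≡-Reasoning

  maximum≤ : ∀ {m e} → All (_≤ m) e → maximum e ≤ m
  maximum≤ [] = z≤n
  maximum≤ (a≤m ∷ r≤m) = ⊔-lub a≤m (maximum≤ r≤m)

  label : ℕ → List ℕ → Label
  label p e = p ∸ threshold e , p ∸ maximum e

  extensions : ℕ → List ℕ → List (List ℕ)
  extensions p e = map (λ x → e ++ [ x ]) (interval (threshold e) (suc p ∸ threshold e))

  label-extensions : ∀ p e → maximum e ≤ p → map (label (suc p)) (extensions p e) ≡ children (label p e)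
  label-extensions p e M≤p = begin
    map (label (suc p)) (map (λ x → e ++ [ x ]) (interval t (suc p ∸ t)))
      ≡⟨ map-∘ (interval t (suc p ∸ t)) ⟨
    map F (interval t (suc p ∸ t))
      ≡⟨ cong (map F) (interval-split t≤M M≤p) ⟩
    map F (interval t (suc (M ∸ t)) ++ interval (suc M) (p ∸ M))
      ≡⟨ map-++ F (interval t (suc (M ∸ t))) _ ⟩
    map F (interval t (suc (M ∸ t))) ++ map F (interval (suc M) (p ∸ M))
      ≡⟨ cong₂ _++_ (map-interval-const t (suc (M ∸ t)) (t+1+[M∸t]≡1+M t≤M) low)
                    (map-interval-downFrom (suc M) (p ∸ M) (cong suc (m+[n∸m]≡n M≤p)) high) ⟩
    replicate (suc (M ∸ t)) top ++ side
      ≡⟨ cong (λ n → replicate (suc n) top ++ side) [p∸t]∸[p∸M]≡M∸t ⟨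
    children (label p e) ∎
    where
    open ≡-Reasoning
    t = threshold e
    M = maximum e
    F = label (suc p) ∘ λ x → e ++ [ x ]
    top = (suc (p ∸ M) , suc (p ∸ M))
    side = map (suc (p ∸ t) ,_) (applyDownFrom suc (p ∸ M))
    t≤M = threshold≤maximum e
    [p∸t]∸[p∸M]≡M∸t : (p ∸ t) ∸ (p ∸ M) ≡ M ∸ t
    [p∸t]∸[p∸M]≡M∸t =
      trans (cong (_∸ (p ∸ M)) (trans (∸-split t≤M M≤p) (+-comm (p ∸ M) (M ∸ t)))) (m+n∸n≡m (M ∸ t) (p ∸ M))
    low : ∀ {x} → x < suc M → F x ≡ top
    low {x} (s≤s x≤M) = cong₂ _,_
      (trans (cong (suc p ∸_) (threshold-snoc-below e x≤M)) (+-∸-assoc 1 M≤p))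
      (trans (cong (suc p ∸_) (trans (maximum-snoc e x) (m≥n⇒m⊔n≡m x≤M))) (+-∸-assoc 1 M≤p))
    high : ∀ {x} → suc M ≤ x → F x ≡ (suc (p ∸ t) , suc p ∸ x)
    high {x} M<x = cong₂ _,_
      (trans (cong (suc p ∸_) (threshold-snoc-above e M<x)) (+-∸-assoc 1 (≤-trans t≤M M≤p)))
      (cong (suc p ∸_) (trans (maximum-snoc e x) (m≤n⇒m⊔n≡n (<⇒≤ M<x))))

  avoids? : Decidable (λ e → ¬ HasPat e)
  avoids? e = ¬? (hasPat? e)

  I-bounded : ∀ p → All (All (_< p)) (I p)
  I-bounded zero = [] ∷ []
  I-bounded (suc p) = concat⁺ (map⁺ (All.map extend (I-bounded p)))
    where
    extend : ∀ {e} → All (_< p) e → All (All (_< suc p)) (map (λ x → e ++ [ x ]) (upTo (suc p)))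
    extend e<p = map⁺ (applyUpTo⁺₁ id (suc p) λ x<1+p → ++⁺ (All.map m≤n⇒m≤1+n e<p) (x<1+p ∷ []))

  Iavoid-bounded : ∀ p → All (All (_< p)) (Iavoid p)
  Iavoid-bounded p = filter⁺ avoids? (I-bounded p)

  threshold≤ : ∀ {p e} → All (_< p) e → threshold e ≤ p
  threshold≤ {e = e} e<p = ≤-trans (threshold≤maximum e) (maximum≤ (All.map <⇒≤ e<p))

  extensions-of-avoider : ∀ p {e} → All (_< p) e → ¬ HasPat e →
    filter avoids? (map (λ x → e ++ [ x ]) (upTo (suc p))) ≡ extensions p e
  extensions-of-avoider p {e} e<p avoids = begin
    filter avoids? (map snoc (upTo (suc p)))
      ≡⟨ cong (filter avoids? ∘ map snoc) (trans (applyUpTo≡interval id 0 (suc p) λ _ → refl) split) ⟩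
    filter avoids? (map snoc (interval 0 t ++ interval t (suc p ∸ t)))
      ≡⟨ cong (filter avoids?) (map-++ snoc (interval 0 t) _) ⟩
    filter avoids? (map snoc (interval 0 t) ++ map snoc (interval t (suc p ∸ t)))
      ≡⟨ filter-++ avoids? (map snoc (interval 0 t)) _ ⟩
    filter avoids? (map snoc (interval 0 t)) ++ filter avoids? (map snoc (interval t (suc p ∸ t)))
      ≡⟨ cong₂ _++_ (filter-none avoids? (map⁺ (interval⁺ 0 t λ _ x<t avoid → avoid (HasPat-snoc-below e x<t))))
                    (filter-all avoids? (map⁺ (interval⁺ t _ λ t≤x _ → ¬HasPat-snoc e avoids t≤x))) ⟩
    extensions p e ∎
    where
    open ≡-Reasoning
    t = threshold e
    snoc = λ x → e ++ [ x ]
    split : interval 0 (suc p) ≡ interval 0 t ++ interval t (suc p ∸ t)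
    split = trans (cong (interval 0) (sym (m+[n∸m]≡n (m≤n⇒m≤1+n (threshold≤ e<p))))) (interval-++ 0 t (suc p ∸ t))

  Iavoid-suc : ∀ p → Iavoid (suc p) ≡ concatMap (extensions p) (Iavoid p)
  Iavoid-suc p = trans (filter-concatMap avoids? _ (I p))
    (concatMap-filter avoids? (I-bounded p) (λ e<p → extensions-of-avoider p e<p)
      λ {e} ¬avoids → filter-none avoids? (map⁺ (All.universal (λ x avoid → ¬avoids (avoid ∘ HasPat-++ e [ x ])) _)))

  labels-level : ∀ q → map (label (suc q)) (Iavoid (suc q)) ≡ level q
  labels-level zero = refl
  labels-level (suc q) = begin
    map (label (2 + q)) (Iavoid (2 + q))
      ≡⟨ cong (map (label (2 + q))) (Iavoid-suc (suc q)) ⟩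
    map (label (2 + q)) (concatMap (extensions (suc q)) (Iavoid (suc q)))
      ≡⟨ map-concatMap (label (2 + q)) (extensions (suc q)) (Iavoid (suc q)) ⟩
    concatMap (map (label (2 + q)) ∘ extensions (suc q)) (Iavoid (suc q))
      ≡⟨ cong concat (map-cong-local (All.map (λ {e} e<p → label-extensions (suc q) e (maximum≤ (All.map <⇒≤ e<p)))
                                              (Iavoid-bounded (suc q)))) ⟩
    concatMap (children ∘ label (suc q)) (Iavoid (suc q))
      ≡⟨ concatMap-map children (label (suc q)) (Iavoid (suc q)) ⟨
    concatMap children (map (label (suc q)) (Iavoid (suc q)))
      ≡⟨ cong (concatMap children) (labels-level q) ⟩
    level (suc q) ∎
    where open ≡-Reasoning

  last-snoc : ∀ (e : List A) x → last (e ++ [ x ]) ≡ just x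
  last-snoc [] x = refl
  last-snoc (a ∷ []) x = refl
  last-snoc (a ∷ b ∷ e) x = last-snoc (b ∷ e) x

  lastℤ-snoc : ∀ e x → lastℤ (e ++ [ x ]) ≡ just (+ x)
  lastℤ-snoc e x = cong (Maybe.map (λ n → + n)) (last-snoc e x)

  lastIs? : (j : ℤ) → Decidable (λ e → lastℤ e ≡ just j)
  lastIs? j e = ≡-dec ℤ._≟_ (lastℤ e) (just j)

  count-last : ∀ e k xs → length (filter (lastIs? (+ k)) (map (λ x → e ++ [ x ]) xs)) ≡ ∑ (λ x → ⟦ k ≡ x ⟧) xs
  count-last e k [] = refl
  count-last e k (x ∷ xs) with k ≟ x
  ... | yes refl = trans (cong length (filter-accept (lastIs? (+ k)) {x = e ++ [ k ]} {xs = map (λ y → e ++ [ y ]) xs} (lastℤ-snoc e k)))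
                         (cong₂ _+_ (sym (⟦≡⟧-refl k)) (count-last e k xs))
  ... | no k≢x = trans (cong length (filter-reject (lastIs? (+ k)) {x = e ++ [ x ]} {xs = map (λ y → e ++ [ y ]) xs} λ last≡k →
                                       k≢x (sym (ℤ.+-injective (just-injective (trans (sym (lastℤ-snoc e x)) last≡k))))))
                       (trans (count-last e k xs) (cong (_+ ∑ (λ x → ⟦ k ≡ x ⟧) xs) (sym (⟦≡⟧-≢ k≢x))))

  ∑-⟦≡⟧-interval : ∀ k a n → k < a + n → ∑ (λ x → ⟦ k ≡ x ⟧) (interval a n) ≡ ⟦ a ≤ k ⟧
  ∑-⟦≡⟧-interval k a zero k<a+0 = sym (⟦≤⟧-> (subst (k <_) (+-identityʳ a) k<a+0))
  ∑-⟦≡⟧-interval k a (suc n) k<a+1+n =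
    trans (cong (λ n → ⟦ k ≡ a ⟧ + n) (∑-⟦≡⟧-interval k (suc a) n (subst (k <_) (+-suc a n) k<a+1+n))) (⟦≡⟧+⟦<⟧ k a)

  S≡∑-threshold≤ : ∀ p k → k ≤ p → S (suc p) (+ k) ≡ ∑ (λ e → ⟦ threshold e ≤ k ⟧) (Iavoid p)
  S≡∑-threshold≤ p k k≤p = begin
    length (filter (lastIs? (+ k)) (Iavoid (suc p)))
      ≡⟨ cong (length ∘ filter (lastIs? (+ k))) (Iavoid-suc p) ⟩
    length (filter (lastIs? (+ k)) (concatMap (extensions p) (Iavoid p)))
      ≡⟨ cong length (filter-concatMap (lastIs? (+ k)) (extensions p) (Iavoid p)) ⟩
    length (concatMap (filter (lastIs? (+ k)) ∘ extensions p) (Iavoid p))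
      ≡⟨ length-concatMap (filter (lastIs? (+ k)) ∘ extensions p) (Iavoid p) ⟩
    ∑ (λ e → length (filter (lastIs? (+ k)) (extensions p e))) (Iavoid p)
      ≡⟨ ∑-cong-local (All.map count (Iavoid-bounded p)) ⟩
    ∑ (λ e → ⟦ threshold e ≤ k ⟧) (Iavoid p) ∎
    where
    open ≡-Reasoning
    count : ∀ {e} → All (_< p) e → length (filter (lastIs? (+ k)) (extensions p e)) ≡ ⟦ threshold e ≤ k ⟧
    count {e} e<p = trans (count-last e k (interval (threshold e) (suc p ∸ threshold e))) (∑-⟦≡⟧-interval k (threshold e) _
      (subst (k <_) (sym (m+[n∸m]≡n (m≤n⇒m≤1+n (threshold≤ e<p)))) (s≤s k≤p)))

  S≡count≥ : ∀ q {j} k → j + k ≡ suc q → S (2 + q) (+ k) ≡ count≥ q j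
  S≡count≥ q {j} k j+k≡1+q = begin
    S (2 + q) (+ k)
      ≡⟨ S≡∑-threshold≤ (suc q) k (subst (k ≤_) j+k≡1+q (m≤n+m k j)) ⟩
    ∑ (λ e → ⟦ threshold e ≤ k ⟧) (Iavoid (suc q))
      ≡⟨ ∑-cong-local (All.map (λ e<p → ⟦≤⟧-flip j+k≡1+q (threshold≤ e<p)) (Iavoid-bounded (suc q))) ⟩
    ∑ (λ e → ⟦ j ≤ suc q ∸ threshold e ⟧) (Iavoid (suc q))
      ≡⟨ ∑-map (λ (c , _) → ⟦ j ≤ c ⟧) (label (suc q)) (Iavoid (suc q)) ⟨
    ∑ (λ (c , _) → ⟦ j ≤ c ⟧) (map (label (suc q)) (Iavoid (suc q)))
      ≡⟨ cong (∑ (λ (c , _) → ⟦ j ≤ c ⟧)) (labels-level q) ⟩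
    count≥ q j ∎
    where open ≡-Reasoning

  S-negative : ∀ n m → S n -[1+ m ] ≡ 0
  S-negative n m = cong length (filter-none (lastIs? -[1+ m ]) (All.universal never (Iavoid n)))
    where
    never : ∀ e → ¬ lastℤ e ≡ just -[1+ m ]
    never e with last e
    ... | nothing = λ ()
    ... | just x = λ ()

  S-pred≡count≥ : ∀ q {j} k → j + k ≡ 2 + q → S (2 + q) (+ k ℤ.- + 1) ≡ count≥ q j
  S-pred≡count≥ q {j} zero j+0≡2+q =
    trans (S-negative (2 + q) 0) (sym (count≥-beyond q j (≤-reflexive (trans (sym j+0≡2+q) (+-identityʳ j)))))
  S-pred≡count≥ q {j} (suc k) j+1+k≡2+q = S≡count≥ q k (suc-injective (trans (sym (+-suc j k)) j+1+k≡2+q))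

  S-recurrence : ∀ r k → k ≤ r →
    S (3 + r) (+ k) + S (2 + r) (+ k ℤ.- + 1) ≡ S (3 + r) (+ k ℤ.- + 1) + 2 * S (2 + r) (+ k)
  S-recurrence r k k≤r = begin
    S (3 + r) (+ k) + S (2 + r) (+ k ℤ.- + 1)
      ≡⟨ cong₂ _+_ (S≡count≥ (suc r) k (cong (λ n → 2 + n) i+k≡r)) (S-pred≡count≥ r k (cong (λ n → 2 + n) i+k≡r)) ⟩
    count≥ (suc r) (2 + i) + count≥ r (2 + i)
      ≡⟨ count≥-recurrence r i ⟩
    count≥ (suc r) (3 + i) + 2 * count≥ r (1 + i)
      ≡⟨ cong₂ (λ a b → a + 2 * b) (S-pred≡count≥ (suc r) k (cong (λ n → 3 + n) i+k≡r)) (S≡count≥ r k (cong suc i+k≡r)) ⟨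
    S (3 + r) (+ k ℤ.- + 1) + 2 * S (2 + r) (+ k) ∎
    where
    open ≡-Reasoning
    i = r ∸ k
    i+k≡r : i + k ≡ r
    i+k≡r = m∸n+n≡m k≤r

open import Defs
open import Data.Nat using (ℕ; suc; s≤s; _≤_; _∸_)
import Data.Nat as ℕ
open import Data.Integer using (ℤ; +_; _+_; _-_; _*_)
import Data.Integer.Properties as ℤ
open import Data.Integer.Tactic.RingSolver using (solve-∀)
open import Relation.Binary.PropositionalEquality using (_≡_; cong; trans; module ≡-Reasoning)
open Enumeration using (S-recurrence)

ℕ-identity⇒ℤ : ∀ {a b c d} → a ℕ.+ d ≡ b ℕ.+ 2 ℕ.* c → + a ≡ (+ b + + 2 * + c) - + d
ℕ-identity⇒ℤ {a} {b} {c} {d} a+d≡b+2c = begin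
  + a                      ≡⟨ cancel (+ a) (+ d) ⟩
  + a + + d - + d          ≡⟨ cong (λ i → i - + d) (ℤ.pos-+ a d) ⟨
  + (a ℕ.+ d) - + d        ≡⟨ cong (λ n → + n - + d) a+d≡b+2c ⟩
  + (b ℕ.+ 2 ℕ.* c) - + d  ≡⟨ cong (λ i → i - + d) (trans (ℤ.pos-+ b (2 ℕ.* c)) (cong (λ i → + b + i) (ℤ.pos-* 2 c))) ⟩
  + b + + 2 * + c - + d    ∎
  where
  open ≡-Reasoning
  cancel : ∀ i j → i ≡ i + j - j
  cancel = solve-∀

lemma3p2 : (n k : ℕ) → 3 ≤ n → k ≤ n ∸ 3 →
    + S n (+ k) ≡ (+ S n (+ k - + 1) + + 2 * + S (n ∸ 1) (+ k)) - + S (n ∸ 1) (+ k - + 1)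
-- c is supplied because it occurs only under 2 * c, which unification cannot invert.
lemma3p2 n@(suc (suc (suc r))) k (s≤s (s≤s (s≤s _))) k≤r =
  ℕ-identity⇒ℤ {c = S (n ∸ 1) (+ k)} (S-recurrence r k k≤r)
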